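{- Let $k$, $c$ and $n$ be positive integers and let $F=(V,E)$ be a $(2,3)$-graph on at least $5^{k-1}cn$ vertices. If $F$ contains no $(2,3)$-path with $n$ vertices, then there exist pairwise disjoint sets $V_1,\dots,V_k\subseteq V$, each of size at least $cn$, such that no edge of $E$ is a transversal with respect to $V_1,\dots,V_k$, and there is no edge $uv(w)\in E$ with $u\in V_1\cup\dots\cup V_{k-1}$ and $v,w\in V_k$.
   Context: A $(2,3)$-graph $F=(V,E)$ consists of a vertex set $V$ and a set $E$ of edges of two kinds: $2$-edges, which are unordered pairs $\{u,v\}$ (written $uv$), and $3$-edges, which are pairs $(\{u,v\},w)$ (written $uv(w)$), where $u,v,w\in V$ are distinct. A sequence of distinct vertices $(x_1,\dots,x_m)$ is a $(2,3)$-path with $m$ vertices in $F$ if for every $i=1,\dots,m-1$ either $x_ix_{i+1}\in E$ or $x_ix_{i+1}(w_i)\in E$ for some $w_i\in V\setminus\{x_1,\dots,x_m\}$, where all the vertices $w_i$ used are distinct. Given pairwise disjoint sets $V_1,\dots,V_k$, an edge $uv\in E$ is a transversal (with respect to $V_1,\dots,V_k$) if $u$ and $v$ lie in two different sets $V_i$, and an edge $uv(w)\in E$ is a transversal if $u$, $v$ and $w$ lie in three pairwise different sets $V_i$. -}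

module Defs where

open import Data.Nat using (ℕ; suc; _<_)
open import Data.Bool using (Bool; true; false; _∨_)
open import Data.Fin using (Fin; toℕ)
open import Data.Fin.Subset using (Subset; _∈_; _∉_)
open import Data.Maybe using (Maybe; just; nothing)
open import Data.Product using (Σ; ∃; ∃-syntax; _×_)
open import Relation.Binary.PropositionalEquality using (_≡_; _≢_)
open import Relation.Nullary using (¬_)

-- E2 u v ≡ true  means the 2-edge uv is present; E3 u v w ≡ true means the
-- 3-edge uv(w) is present.  Since edges are unordered in {u,v}, we use the
-- symmetric closures adj2 / adj3 below as "the edge is in E".
record Graph23 (N : ℕ) : Set where
  field
    E2 : Fin N → Fin N → Bool
    E3 : Fin N → Fin N → Fin N → Bool
    E2-distinct : ∀ u v → E2 u v ≡ true → u ≢ v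
    E3-distinct : ∀ u v w → E3 u v w ≡ true → u ≢ v × u ≢ w × v ≢ w

  adj2 : Fin N → Fin N → Bool
  adj2 u v = E2 u v ∨ E2 v u

  adj3 : Fin N → Fin N → Fin N → Bool
  adj3 u v w = E3 u v w ∨ E3 v u w

open Graph23 public

-- For each consecutive pair
-- (x i, x j) with toℕ j = toℕ i + 1, the link is either the 2-edge x_i x_j
-- (w i ≡ nothing) or a 3-edge x_i x_j (w_i) (w i ≡ just w_i), where w_i is
-- outside the path and all the w_i used are distinct.
record Path23 {N : ℕ} (F : Graph23 N) (m : ℕ) : Set where
  field
    x : Fin m → Fin N
    x-distinct : ∀ i j → x i ≡ x j → i ≡ j
    w : Fin m → Maybe (Fin N)
    link2 : ∀ i j → toℕ j ≡ suc (toℕ i) → w i ≡ nothing →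
            adj2 F (x i) (x j) ≡ true
    link3 : ∀ i j v → toℕ j ≡ suc (toℕ i) → w i ≡ just v →
            adj3 F (x i) (x j) v ≡ true
    w-outside : ∀ i v → w i ≡ just v → ∀ j → x j ≢ v
    w-distinct : ∀ i i' v → w i ≡ just v → w i' ≡ just v → i ≡ i'

Transversal2 : {N k : ℕ} → (Fin k → Subset N) → Fin N → Fin N → Set
Transversal2 V u v = ∃[ i ] ∃[ j ] (i ≢ j × u ∈ V i × v ∈ V j)

Transversal3 : {N k : ℕ} → (Fin k → Subset N) → Fin N → Fin N → Fin N → Set
Transversal3 V u v w =
  ∃[ i ] ∃[ j ] ∃[ l ] (i ≢ j × i ≢ l × j ≢ l × u ∈ V i × v ∈ V j × w ∈ V l)

-- The parts are built one at a time by a depth-first search. In round r a path is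
-- grown from its last vertex x by a free vertex t, along a 2-edge xt or along a
-- 3-edge xt(w) whose third vertex w is free or lies in an earlier part (w is then
-- used up); when no such extension exists, x is moved into part r. Hence a vertex of
-- part r has no transversal edge to the vertices that are still free, and as F has
-- no (2,3)-path on n vertices the path stays shorter than n. A round thus costs
-- O(|part r| + n) free vertices and removes at most that many vertices from earlier
-- parts; oversizing each part by the total loss of the later rounds, k - 1 rounds
-- and a free remainder of size cn fit into 5^(k-1)cn vertices.

module Submission where

open import Defs
open import Data.Bool using (Bool; true; false; if_then_else_)
open import Data.Bool.Properties using (∨-comm; T-≡) renaming (_≟_ to _≟ᵇ_)
open import Data.Empty using (⊥; ⊥-elim)
open import Data.Fin using (Fin; zero; suc; toℕ)
open import Data.Fin.Properties using (toℕ<n; toℕ-injective; any?)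
  renaming (_≟_ to _≟ᶠ_; suc-injective to suc-injectiveᶠ)
open import Data.Fin.Subset using (Subset; _∈_; ∣_∣)
open import Data.List using (List; []; _∷_; length; lookup)
open import Data.Maybe using (Maybe; just; nothing)
open import Data.Nat
open import Data.Nat.Properties
open import Data.Nat.Tactic.RingSolver using (solve-∀)
open import Data.Product using (Σ; ∃-syntax; _×_; _,_; proj₁; proj₂)
open import Data.Sum using (_⊎_; inj₁; inj₂)
open import Data.Unit using (⊤; tt)
open import Data.Vec using (tabulate)
open import Data.Vec.Properties using (lookup∘tabulate; []=⇒lookup)
open import Data.Vec.Functional using (updateAt)
open import Data.Vec.Functional.Properties using (updateAt-updates; updateAt-minimal)
open import Function using (_∘_; const; id)
open import Function.Bundles using (Equivalence)
open import Relation.Binary.Definitions using (tri<; tri≈; tri>)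
open import Relation.Binary.PropositionalEquality
open import Relation.Nullary using (¬_; yes; no)
open import Relation.Nullary.Decidable using (_×-dec_)

bit : Bool → ℕ
bit true  = 1
bit false = 0

bit≤1 : ∀ b → bit b ≤ 1
bit≤1 true  = ≤-refl
bit≤1 false = z≤n

count : ∀ {N} → (Fin N → Bool) → ℕ
count {zero}  f = 0
count {suc N} f = bit (f zero) + count (f ∘ suc)

count-cong : ∀ {N} {f g : Fin N → Bool} → (∀ v → f v ≡ g v) → count f ≡ count g
count-cong {zero}  f≗g = refl
count-cong {suc N} f≗g = cong₂ _+_ (cong bit (f≗g zero)) (count-cong (f≗g ∘ suc))

count-update : ∀ {N} (f g : Fin N → Bool) x → (∀ v → v ≢ x → g v ≡ f v) →
               count g + bit (f x) ≡ count f + bit (g x)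
count-update {suc N} f g zero g≗f =
  begin
    bit (g zero) + count (g ∘ suc) + bit (f zero)
  ≡⟨ cong (λ k → bit (g zero) + k + bit (f zero)) (count-cong (λ v → g≗f (suc v) λ ())) ⟩
    bit (g zero) + count (f ∘ suc) + bit (f zero)
  ≡⟨ swap (bit (g zero)) (count (f ∘ suc)) (bit (f zero)) ⟩
    bit (f zero) + count (f ∘ suc) + bit (g zero)
  ∎
  where
  open ≡-Reasoning
  swap : ∀ a b c → a + b + c ≡ c + b + a
  swap = solve-∀
count-update {suc N} f g (suc x) g≗f =
  begin
    bit (g zero) + count (g ∘ suc) + bit (f (suc x))
  ≡⟨ +-assoc (bit (g zero)) _ _ ⟩
    bit (g zero) + (count (g ∘ suc) + bit (f (suc x)))
  ≡⟨ cong₂ _+_ (cong bit (g≗f zero λ ()))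
               (count-update (f ∘ suc) (g ∘ suc) x λ v v≢x → g≗f (suc v) (v≢x ∘ suc-injectiveᶠ)) ⟩
    bit (f zero) + (count (f ∘ suc) + bit (g (suc x)))
  ≡⟨ +-assoc (bit (f zero)) _ _ ⟨
    bit (f zero) + count (f ∘ suc) + bit (g (suc x))
  ∎
  where open ≡-Reasoning

count-witness : ∀ {N} (f : Fin N → Bool) → 0 < count f → ∃[ v ] f v ≡ true
count-witness {suc N} f 0<count with f zero in f0
... | true  = zero , f0
... | false = let v , fv = count-witness (f ∘ suc) 0<count in suc v , fv

count-false : ∀ {N} (f : Fin N → Bool) → (∀ v → f v ≡ false) → count f ≡ 0
count-false {zero}  f all-false = refl
count-false {suc N} f all-false =
  cong₂ _+_ (cong bit (all-false zero)) (count-false (f ∘ suc) (all-false ∘ suc))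

count-true : ∀ {N} (f : Fin N → Bool) → (∀ v → f v ≡ true) → count f ≡ N
count-true {zero}  f all-true = refl
count-true {suc N} f all-true =
  cong₂ _+_ (cong bit (all-true zero)) (count-true (f ∘ suc) (all-true ∘ suc))

∣tabulate∣≡count : ∀ {N} (f : Fin N → Bool) → ∣ tabulate f ∣ ≡ count f
∣tabulate∣≡count {zero}  f = refl
∣tabulate∣≡count {suc N} f with f zero | ∣tabulate∣≡count (f ∘ suc)
... | true  | eq = cong suc eq
... | false | eq = eq

∈-tabulate : ∀ {N} (f : Fin N → Bool) u → u ∈ tabulate f → f u ≡ true
∈-tabulate f u u∈ = trans (sym (lookup∘tabulate f u)) ([]=⇒lookup u∈)

-- part a is the paper's V_(a+1); the vertices still free at the end form V_k. The
-- path vertex at depth d (counted from the bottom of the stack) is onPath d, and the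
-- third vertex of the 3-edge joining it to the vertex below it is helper d.
data Status : Set where
  free      : Status
  part      : ℕ → Status
  onPath    : ℕ → Status
  helper    : ℕ → Status
  discarded : Status

part-injective : ∀ {a b} → part a ≡ part b → a ≡ b
part-injective refl = refl

onPath-injective : ∀ {a b} → onPath a ≡ onPath b → a ≡ b
onPath-injective refl = refl

helper-injective : ∀ {a b} → helper a ≡ helper b → a ≡ b
helper-injective refl = refl

isFree : Status → Bool
isFree free = true
isFree _    = false

isPart : ℕ → Status → Bool
isPart a (part b) = a ≡ᵇ b
isPart a _        = false

-- Helpers may come from earlier parts, so that vertices popped into part r are also
-- blocked through third vertices there; third vertices in part r itself are harmless,
-- since such 3-edges are never transversal.
canHelp : ℕ → Status → Bool
canHelp r free     = true
canHelp r (part c) = c <ᵇ r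
canHelp r _        = false

isFree⇒≡free : ∀ {L} → isFree L ≡ true → L ≡ free
isFree⇒≡free {free} _ = refl

isPart-self : ∀ a → isPart a (part a) ≡ true
isPart-self a = Equivalence.to T-≡ (≡⇒≡ᵇ a a refl)

isPart-other : ∀ {a b} → a ≢ b → isPart a (part b) ≡ false
isPart-other {a} {b} a≢b with a ≡ᵇ b in eq
... | true  = ⊥-elim (a≢b (≡ᵇ⇒≡ a b (Equivalence.from T-≡ eq)))
... | false = refl

isPart⇒≡part : ∀ a L → isPart a L ≡ true → L ≡ part a
isPart⇒≡part a (part b) eq = cong part (sym (≡ᵇ⇒≡ a b (Equivalence.from T-≡ eq)))

canHelp-part⇒< : ∀ {r c} → canHelp r (part c) ≡ true → c < r
canHelp-part⇒< {r} {c} eq = <ᵇ⇒< c r (Equivalence.from T-≡ eq)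

<⇒canHelp-part : ∀ {r c} → c < r → canHelp r (part c) ≡ true
<⇒canHelp-part c<r = Equivalence.to T-≡ (<⇒<ᵇ c<r)

After : ℕ → Status → Set
After a free       = ⊤
After a (part b)   = a < b
After a (onPath _) = ⊤
After a (helper _) = ⊥
After a discarded  = ⊥

Before : ℕ → Status → Set
Before a (part c) = c < a
Before a _        = ⊥

Elsewhere : ℕ → Status → Set
Elsewhere a L = After a L ⊎ Before a L

data Advance (r : ℕ) : Status → Status → Set where
  stay               : ∀ {L} → Advance r L L
  free→onPath        : ∀ {d} → Advance r free (onPath d)
  free→helper        : ∀ {d} → Advance r free (helper d)
  part→helper        : ∀ {c d} → c < r → Advance r (part c) (helper d)
  helper→discarded   : ∀ {d} → Advance r (helper d) discarded
  onPath→discarded   : ∀ {d} → Advance r (onPath d) discarded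

Advance-part : ∀ {r L L' a} → Advance r L L' → L' ≡ part a → L ≡ part a
Advance-part stay eq = eq

Advance-free : ∀ {r L L'} → Advance r L L' → L' ≡ free → L ≡ free
Advance-free stay eq = eq

Advance-After : ∀ {r L L' a} → Advance r L L' → After a L' → After a L
Advance-After stay        after = after
Advance-After free→onPath after = tt

Advance-Before : ∀ {r L L' a} → Advance r L L' → Before a L' → Before a L
Advance-Before stay before = before

Advance-canHelp : ∀ {r L L'} → Advance r L L' → canHelp r L' ≡ true → canHelp r L ≡ true
Advance-canHelp stay eq = eq

discard : Status → Status
discard (onPath _) = discarded
discard (helper _) = discarded
discard L          = L

Advance-discard : ∀ r L → Advance r L (discard L)
Advance-discard r free       = stay
Advance-discard r (part _)   = stay
Advance-discard r (onPath _) = onPath→discarded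
Advance-discard r (helper _) = helper→discarded
Advance-discard r discarded  = stay

discard-part : ∀ {L b} → discard L ≡ part b → L ≡ part b
discard-part {part _} eq = eq

isFree-discard : ∀ L → isFree (discard L) ≡ isFree L
isFree-discard free       = refl
isFree-discard (part _)   = refl
isFree-discard (onPath _) = refl
isFree-discard (helper _) = refl
isFree-discard discarded  = refl

isPart-discard : ∀ a L → isPart a (discard L) ≡ isPart a L
isPart-discard a free       = refl
isPart-discard a (part _)   = refl
isPart-discard a (onPath _) = refl
isPart-discard a (helper _) = refl
isPart-discard a discarded  = refl

After-discard⇒free : ∀ {r} L → (∀ b → L ≡ part b → b ≤ r) → After r (discard L) → L ≡ free
After-discard⇒free free     parts≤ after = refl
After-discard⇒free (part b) parts≤ after = ⊥-elim (<⇒≱ after (parts≤ b refl))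

Elsewhere-discard⇒canHelp : ∀ {r} L → (∀ b → L ≡ part b → b ≤ r) →
                            Elsewhere r (discard L) → canHelp r L ≡ true
Elsewhere-discard⇒canHelp {r} L parts≤ (inj₁ after) =
  subst (λ S → canHelp r S ≡ true) (sym (After-discard⇒free L parts≤ after)) refl
Elsewhere-discard⇒canHelp (part b)   parts≤ (inj₂ before) = <⇒canHelp-part before

Labelling : ℕ → Set
Labelling N = Fin N → Status

_[_]≔_ : ∀ {N} → Labelling N → Fin N → Status → Labelling N
lab [ x ]≔ L = updateAt lab x (const L)

module _ {N : ℕ} (lab : Labelling N) (x : Fin N) (L : Status) where

  ≔-updates : (lab [ x ]≔ L) x ≡ L
  ≔-updates = updateAt-updates x lab

  ≔-minimal : ∀ v → v ≢ x → (lab [ x ]≔ L) v ≡ lab v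
  ≔-minimal v v≢x = updateAt-minimal v x lab v≢x

  ≔-Advance : ∀ r → Advance r (lab x) L → ∀ v → Advance r (lab v) ((lab [ x ]≔ L) v)
  ≔-Advance r adv v with v ≟ᶠ x
  ... | yes refl = subst (Advance r (lab x)) (sym ≔-updates) adv
  ... | no v≢x   = subst (Advance r (lab v)) (sym (≔-minimal v v≢x)) stay

  count-≔ : (p : Status → Bool) → count (p ∘ (lab [ x ]≔ L)) + bit (p (lab x)) ≡ count (p ∘ lab) + bit (p L)
  count-≔ p = subst (λ L' → count (p ∘ (lab [ x ]≔ L)) + bit (p (lab x)) ≡ count (p ∘ lab) + bit (p L'))
                    ≔-updates
                    (count-update (p ∘ lab) (p ∘ (lab [ x ]≔ L)) x (λ v v≢x → cong p (≔-minimal v v≢x)))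

  count-≔-same : (p : Status → Bool) → p (lab x) ≡ p L → count (p ∘ (lab [ x ]≔ L)) ≡ count (p ∘ lab)
  count-≔-same p eq = +-cancelʳ-≡ _ _ _ (trans (count-≔ p) (cong (λ b → count (p ∘ lab) + bit b) (sym eq)))

  count-≔-lose : (p : Status → Bool) → p (lab x) ≡ true → p L ≡ false →
                 count (p ∘ (lab [ x ]≔ L)) + 1 ≡ count (p ∘ lab)
  count-≔-lose p before after = begin
    count (p ∘ (lab [ x ]≔ L)) + 1            ≡⟨ cong (λ b → count (p ∘ (lab [ x ]≔ L)) + bit b) before ⟨
    count (p ∘ (lab [ x ]≔ L)) + bit (p (lab x)) ≡⟨ count-≔ p ⟩
    count (p ∘ lab) + bit (p L)               ≡⟨ cong (λ b → count (p ∘ lab) + bit b) after ⟩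
    count (p ∘ lab) + 0                       ≡⟨ +-identityʳ _ ⟩
    count (p ∘ lab)                           ∎
    where open ≡-Reasoning

  count-≔-gain : (p : Status → Bool) → p (lab x) ≡ false → p L ≡ true →
                 count (p ∘ (lab [ x ]≔ L)) ≡ suc (count (p ∘ lab))
  count-≔-gain p before after = begin
    count (p ∘ (lab [ x ]≔ L))                ≡⟨ +-identityʳ _ ⟨
    count (p ∘ (lab [ x ]≔ L)) + 0            ≡⟨ cong (λ b → count (p ∘ (lab [ x ]≔ L)) + bit b) before ⟨
    count (p ∘ (lab [ x ]≔ L)) + bit (p (lab x)) ≡⟨ count-≔ p ⟩
    count (p ∘ lab) + bit (p L)               ≡⟨ cong (λ b → count (p ∘ lab) + bit b) after ⟩
    count (p ∘ lab) + 1                       ≡⟨ +-comm _ 1 ⟩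
    suc (count (p ∘ lab))                     ∎
    where open ≡-Reasoning

  count-≔-≥ : (p : Status → Bool) → count (p ∘ lab) ≤ count (p ∘ (lab [ x ]≔ L)) + 1
  count-≔-≥ p = begin
    count (p ∘ lab)                              ≤⟨ m≤m+n _ (bit (p L)) ⟩
    count (p ∘ lab) + bit (p L)                  ≡⟨ count-≔ p ⟨
    count (p ∘ (lab [ x ]≔ L)) + bit (p (lab x)) ≤⟨ +-monoʳ-≤ _ (bit≤1 (p (lab x))) ⟩
    count (p ∘ (lab [ x ]≔ L)) + 1               ∎
    where open ≤-Reasoning

  count-≔-≤ : (p : Status → Bool) → p L ≡ false → count (p ∘ (lab [ x ]≔ L)) ≤ count (p ∘ lab)
  count-≔-≤ p after = begin
    count (p ∘ (lab [ x ]≔ L))                   ≤⟨ m≤m+n _ _ ⟩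
    count (p ∘ (lab [ x ]≔ L)) + bit (p (lab x)) ≡⟨ count-≔ p ⟩
    count (p ∘ lab) + bit (p L)                  ≡⟨ cong (λ b → count (p ∘ lab) + bit b) after ⟩
    count (p ∘ lab) + 0                          ≡⟨ +-identityʳ _ ⟩
    count (p ∘ lab)                              ∎
    where open ≤-Reasoning

depth-injective : ∀ L (i j : Fin L) → L ∸ suc (toℕ i) ≡ L ∸ suc (toℕ j) → i ≡ j
depth-injective (suc L) zero    zero    eq = refl
depth-injective (suc L) zero    (suc j) eq =
  ⊥-elim (<-irrefl (sym eq) (∸-monoʳ-< {L} {suc (toℕ j)} {0} z<s (toℕ<n j)))
depth-injective (suc L) (suc i) zero    eq =
  ⊥-elim (<-irrefl eq (∸-monoʳ-< {L} {suc (toℕ i)} {0} z<s (toℕ<n i)))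
depth-injective (suc L) (suc i) (suc j) eq = cong suc (depth-injective L i j eq)

measure-push : ∀ f f' l → f' + 1 ≤ f → 2 * f' + suc l < 2 * f + l
measure-push f f' l f'<f = begin-strict
  2 * f' + suc l       <⟨ n<1+n _ ⟩
  suc (2 * f' + suc l) ≡⟨ shift f' l ⟩
  2 * (f' + 1) + l     ≤⟨ +-monoˡ-≤ l (*-monoʳ-≤ 2 f'<f) ⟩
  2 * f + l            ∎
  where
  open ≤-Reasoning
  shift : ∀ a c → suc (2 * a + suc c) ≡ 2 * (a + 1) + c
  shift = solve-∀

-- With j rounds still to come, the part built now gets target X j vertices: X plus
-- loss X j, which bounds what the later rounds take from it as helpers; demand X j
-- free vertices suffice for those j rounds and the final X free vertices.
target : ℕ → ℕ → ℕ
loss   : ℕ → ℕ → ℕ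

target X j = X + loss X j

loss X zero    = 0
loss X (suc j) = loss X j + (target X j + X)

demand : ℕ → ℕ → ℕ
demand X zero    = X
demand X (suc j) = demand X j + ((target X j + X) + (target X j + X))

loss-demand-bound : ∀ X j → loss X j + (X + X) ≤ 2 * (5 ^ j * X) × demand X j ≤ 5 ^ j * X
loss-demand-bound X zero = ≤-reflexive (base X) , ≤-reflexive (sym (+-identityʳ X))
  where
  base : ∀ x → 0 + (x + x) ≡ 2 * (1 * x)
  base = solve-∀
loss-demand-bound X (suc j) = loss-step , demand-step
  where
  open ≤-Reasoning
  Y : ℕ
  Y = 5 ^ j * X
  loss≤ : loss X j + (X + X) ≤ 2 * Y
  loss≤ = proj₁ (loss-demand-bound X j)
  demand≤ : demand X j ≤ Y
  demand≤ = proj₂ (loss-demand-bound X j)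
  regroup : ∀ l x → l + ((x + l) + x) + (x + x) ≡ 2 * (l + (x + x))
  regroup = solve-∀
  regroup′ : ∀ d l x → d + (((x + l) + x) + ((x + l) + x)) ≡ d + 2 * (l + (x + x))
  regroup′ = solve-∀
  quadruple-plus-one : ∀ y → y + 2 * (2 * y) ≡ 5 * y
  quadruple-plus-one = solve-∀
  loss-step : loss X (suc j) + (X + X) ≤ 2 * (5 ^ suc j * X)
  loss-step = begin
    loss X j + (target X j + X) + (X + X) ≡⟨ regroup (loss X j) X ⟩
    2 * (loss X j + (X + X))              ≤⟨ *-monoʳ-≤ 2 loss≤ ⟩
    2 * (2 * Y)                           ≤⟨ *-monoʳ-≤ 2 (*-monoˡ-≤ Y (m≤m+n 2 3)) ⟩
    2 * (5 * Y)                           ≡⟨ cong (2 *_) (*-assoc 5 (5 ^ j) X) ⟨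
    2 * (5 ^ suc j * X)                   ∎
  demand-step : demand X (suc j) ≤ 5 ^ suc j * X
  demand-step = begin
    demand X j + ((target X j + X) + (target X j + X)) ≡⟨ regroup′ (demand X j) (loss X j) X ⟩
    demand X j + 2 * (loss X j + (X + X))              ≤⟨ +-mono-≤ demand≤ (*-monoʳ-≤ 2 loss≤) ⟩
    Y + 2 * (2 * Y)                                    ≡⟨ quadruple-plus-one Y ⟩
    5 * Y                                              ≡⟨ *-assoc 5 (5 ^ j) X ⟨
    5 ^ suc j * X                                      ∎

module Graph {N : ℕ} (F : Graph23 N) where

  adj2-sym : ∀ u v → adj2 F u v ≡ adj2 F v u
  adj2-sym u v = ∨-comm (E2 F u v) (E2 F v u)

  adj3-sym : ∀ u v w → adj3 F u v w ≡ adj3 F v u w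
  adj3-sym u v w = ∨-comm (E3 F u v w) (E3 F v u w)

  adj3-distinct : ∀ u v w → adj3 F u v w ≡ true → v ≢ w
  adj3-distinct u v w uvw with E3 F u v w in e
  ... | true  = proj₂ (proj₂ (E3-distinct F u v w e))
  ... | false = proj₁ (proj₂ (E3-distinct F v u w uvw))

  Entry : Set
  Entry = Fin N × Maybe (Fin N)

  Step : Entry → Entry → Set
  Step (x , nothing) (y , _) = adj2 F x y ≡ true
  Step (x , just h)  (y , _) = adj3 F x y h ≡ true

  StepsDown : Entry → List Entry → Set
  StepsDown e []       = ⊤
  StepsDown e (e' ∷ _) = Step e e'

  HelperAt : Labelling N → Maybe (Fin N) → ℕ → Set
  HelperAt lab nothing  d = ⊤
  HelperAt lab (just h) d = lab h ≡ helper d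

  WellLabelled : Labelling N → List Entry → Set
  WellLabelled lab [] = ⊤
  WellLabelled lab ((x , h) ∷ rest) =
    lab x ≡ onPath (length rest) × HelperAt lab h (length rest) ×
    StepsDown (x , h) rest × WellLabelled lab rest

  module _ (lab : Labelling N) where

    vertex-label : ∀ stk → WellLabelled lab stk → (i : Fin (length stk)) →
                   lab (proj₁ (lookup stk i)) ≡ onPath (length stk ∸ suc (toℕ i))
    vertex-label (_ ∷ rest) (x-lab , _) zero = x-lab
    vertex-label (_ ∷ rest) (_ , _ , _ , wl) (suc i) = vertex-label rest wl i

    helper-label : ∀ stk → WellLabelled lab stk → (i : Fin (length stk)) → ∀ v →
                   proj₂ (lookup stk i) ≡ just v → lab v ≡ helper (length stk ∸ suc (toℕ i))
    helper-label ((_ , just h) ∷ rest) (_ , h-lab , _) zero v refl = h-lab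
    helper-label (_ ∷ rest) (_ , _ , _ , wl) (suc i) v eq = helper-label rest wl i v eq

    step-at : ∀ stk → WellLabelled lab stk → (i j : Fin (length stk)) → toℕ j ≡ suc (toℕ i) →
              Step (lookup stk i) (lookup stk j)
    step-at (_ ∷ _ ∷ _)  (_ , _ , step , _) zero (suc zero) refl = step
    step-at (_ ∷ rest) (_ , _ , _ , wl) (suc i) (suc j) eq =
      step-at rest wl i j (suc-injective eq)

    Step⇒adj2 : ∀ {e e'} → proj₂ e ≡ nothing → Step e e' → adj2 F (proj₁ e) (proj₁ e') ≡ true
    Step⇒adj2 {_ , nothing} refl step = step

    Step⇒adj3 : ∀ {e e' v} → proj₂ e ≡ just v → Step e e' → adj3 F (proj₁ e) (proj₁ e') v ≡ true
    Step⇒adj3 {_ , just _} refl step = step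

    stack⇒path : ∀ stk → WellLabelled lab stk → Path23 F (length stk)
    stack⇒path stk wl = record
      { x = proj₁ ∘ lookup stk
      ; x-distinct = λ i j eq → depth-injective (length stk) i j
          (onPath-injective (trans (sym (vertex-label stk wl i)) (trans (cong lab eq) (vertex-label stk wl j))))
      ; w = proj₂ ∘ lookup stk
      ; link2 = λ i j j≡i+1 noHelper → Step⇒adj2 noHelper (step-at stk wl i j j≡i+1)
      ; link3 = λ i j v j≡i+1 isHelper → Step⇒adj3 isHelper (step-at stk wl i j j≡i+1)
      ; w-outside = λ i v eq j xj≡v → onPath≢helper
          (trans (sym (vertex-label stk wl j)) (trans (cong lab xj≡v) (helper-label stk wl i v eq)))
      ; w-distinct = λ i i' v eq eq' → depth-injective (length stk) i i'
          (helper-injective (trans (sym (helper-label stk wl i v eq)) (helper-label stk wl i' v eq')))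
      }
      where
      onPath≢helper : ∀ {a b} → onPath a ≢ helper b
      onPath≢helper ()

    OnStack : List Entry → Fin N → Set
    OnStack stk y = ∃[ d ] d < length stk × (lab y ≡ onPath d ⊎ lab y ≡ helper d)

    WellLabelled-≔ : ∀ stk z L → WellLabelled lab stk → (∀ y → OnStack stk y → y ≢ z) →
                     WellLabelled (lab [ z ]≔ L) stk
    WellLabelled-≔ [] z L wl off = tt
    WellLabelled-≔ ((x , h) ∷ rest) z L (x-lab , h-lab , step , wl) off =
      trans (≔-minimal lab z L x (off x (_ , ≤-refl , inj₁ x-lab))) x-lab ,
      helper-kept h h-lab , step ,
      WellLabelled-≔ rest z L wl (λ y (d , d< , lab-y) → off y (d , m≤n⇒m≤1+n d< , lab-y))
      where
      helper-kept : ∀ h → HelperAt lab h (length rest) → HelperAt (lab [ z ]≔ L) h (length rest)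
      helper-kept nothing  _     = tt
      helper-kept (just h) h-lab = trans (≔-minimal lab z L h (off h (_ , ≤-refl , inj₂ h-lab))) h-lab

  Separated : ℕ → Labelling N → Set
  Separated r lab = ∀ s t w a → lab s ≡ part a → a < r → After a (lab t) →
                    ¬ adj2 F s t ≡ true × (Elsewhere a (lab w) → ¬ adj3 F s t w ≡ true)

  Blocked : ℕ → Labelling N → Fin N → Set
  Blocked r lab x = ∀ t w → lab t ≡ free →
                    ¬ adj2 F x t ≡ true × (canHelp r (lab w) ≡ true → ¬ adj3 F x t w ≡ true)

  PartBlocked : ℕ → Labelling N → Set
  PartBlocked r lab = ∀ s → lab s ≡ part r → Blocked r lab s

  AdvanceStep : ℕ → Labelling N → Labelling N → Set
  AdvanceStep r lab lab' = ∀ v → Advance r (lab v) (lab' v)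

  Blocked-transfer : ∀ {r lab lab' x} →
                     (∀ v → lab' v ≡ free → lab v ≡ free) →
                     (∀ v → canHelp r (lab' v) ≡ true → canHelp r (lab v) ≡ true) →
                     Blocked r lab x → Blocked r lab' x
  Blocked-transfer still-free still-helps blocked t w t-free =
    let no-adj2 , no-adj3 = blocked t w (still-free t t-free)
    in no-adj2 , no-adj3 ∘ still-helps w

  module _ {r : ℕ} {lab lab' : Labelling N} (step : AdvanceStep r lab lab') where

    Separated-Advance : Separated r lab → Separated r lab'
    Separated-Advance sep s t w a s-in a<r t-after =
      let no-adj2 , no-adj3 = sep s t w a (Advance-part (step s) s-in) a<r (Advance-After (step t) t-after)
      in no-adj2 , λ { (inj₁ w-after) → no-adj3 (inj₁ (Advance-After (step w) w-after))
                     ; (inj₂ w-before) → no-adj3 (inj₂ (Advance-Before (step w) w-before)) }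

    PartBlocked-Advance : PartBlocked r lab → PartBlocked r lab'
    PartBlocked-Advance pb s s-in =
      Blocked-transfer (λ v → Advance-free (step v)) (λ v → Advance-canHelp (step v))
                       (pb s (Advance-part (step s) s-in))

  module _ {r : ℕ} {lab : Labelling N} {x : Fin N} {d : ℕ} (x-onPath : lab x ≡ onPath d) where

    private
      lab' : Labelling N
      lab' = lab [ x ]≔ part r

      unchanged-or-x : ∀ v → lab' v ≡ lab v ⊎ (v ≡ x × lab' v ≡ part r)
      unchanged-or-x v with v ≟ᶠ x
      ... | yes refl = inj₂ (refl , ≔-updates lab x (part r))
      ... | no v≢x   = inj₁ (≔-minimal lab x (part r) v v≢x)

      still-free : ∀ v → lab' v ≡ free → lab v ≡ free
      still-free v eq with unchanged-or-x v
      ... | inj₁ same         = trans (sym same) eq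
      ... | inj₂ (_ , popped) with () ← trans (sym popped) eq

      still-helps : ∀ v → canHelp r (lab' v) ≡ true → canHelp r (lab v) ≡ true
      still-helps v eq with unchanged-or-x v
      ... | inj₁ same         = subst (λ L → canHelp r L ≡ true) same eq
      ... | inj₂ (_ , popped) =
        ⊥-elim (<-irrefl refl (canHelp-part⇒< {r} {r} (subst (λ L → canHelp r L ≡ true) popped eq)))

    Separated-pop : Separated r lab → Separated r lab'
    Separated-pop sep s t w a s-in a<r t-after =
      let no-adj2 , no-adj3 = sep s t w a (old-part s s-in) a<r (old-after t t-after)
      in no-adj2 , λ { (inj₁ w-after) → no-adj3 (inj₁ (old-after w w-after))
                     ; (inj₂ w-before) → no-adj3 (inj₂ (old-before w w-before)) }
      where
      old-part : ∀ v → lab' v ≡ part a → lab v ≡ part a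
      old-part v eq with unchanged-or-x v
      ... | inj₁ same         = trans (sym same) eq
      ... | inj₂ (_ , popped) = ⊥-elim (<-irrefl (part-injective (trans (sym eq) popped)) a<r)
      old-after : ∀ v → After a (lab' v) → After a (lab v)
      old-after v after with unchanged-or-x v
      ... | inj₁ same            = subst (After a) same after
      ... | inj₂ (refl , popped) = subst (After a) (sym x-onPath) tt
      old-before : ∀ v → Before a (lab' v) → Before a (lab v)
      old-before v before with unchanged-or-x v
      ... | inj₁ same         = subst (Before a) same before
      ... | inj₂ (_ , popped) = ⊥-elim (<-asym a<r (subst (Before a) popped before))

    PartBlocked-pop : Blocked r lab x → PartBlocked r lab → PartBlocked r lab'
    PartBlocked-pop x-blocked pb s s-in with unchanged-or-x s
    ... | inj₁ same     = Blocked-transfer still-free still-helps (pb s (trans (sym same) s-in))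
    ... | inj₂ (refl , _) = Blocked-transfer still-free still-helps x-blocked

  #free : Labelling N → ℕ
  #free lab = count (isFree ∘ lab)

  #part : ℕ → Labelling N → ℕ
  #part a lab = count (isPart a ∘ lab)

  record Sound (r : ℕ) (lab : Labelling N) : Set where
    field
      separated   : Separated r lab
      partBlocked : PartBlocked r lab
      parts≤      : ∀ v b → lab v ≡ part b → b ≤ r

  Sound-Advance : ∀ {r lab lab'} → AdvanceStep r lab lab' → Sound r lab → Sound r lab'
  Sound-Advance step sound = record
    { separated   = Separated-Advance step separated
    ; partBlocked = PartBlocked-Advance step partBlocked
    ; parts≤      = λ v b v-in → parts≤ v b (Advance-part (step v) v-in)
    }
    where open Sound sound

  Sound-pop : ∀ {r lab x d} → lab x ≡ onPath d → Blocked r lab x → Sound r lab → Sound r (lab [ x ]≔ part r)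
  Sound-pop {r} {lab} {x} x-onPath x-blocked sound = record
    { separated   = Separated-pop x-onPath separated
    ; partBlocked = PartBlocked-pop x-onPath x-blocked partBlocked
    ; parts≤      = parts≤′
    }
    where
    open Sound sound
    parts≤′ : ∀ v b → (lab [ x ]≔ part r) v ≡ part b → b ≤ r
    parts≤′ v b v-in with v ≟ᶠ x
    ... | yes refl = ≤-reflexive (part-injective (trans (sym v-in) (≔-updates lab x (part r))))
    ... | no v≢x   = parts≤ v b (trans (sym (≔-minimal lab x (part r) v v≢x)) v-in)

  close-round : ∀ {r lab} → Sound r lab → Separated (suc r) (discard ∘ lab)
  close-round {r} {lab} sound s t w a s-in a<1+r t-after with a <? r
  ... | yes a<r = Separated-Advance (λ v → Advance-discard r (lab v)) separated s t w a s-in a<r t-after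
    where open Sound sound
  ... | no a≮r with ≤-antisym (s≤s⁻¹ a<1+r) (≮⇒≥ a≮r)
  ...   | refl =
    let no-adj2 , no-adj3 = partBlocked s (discard-part s-in) t w
                              (After-discard⇒free (lab t) (parts≤ t) t-after)
    in no-adj2 , no-adj3 ∘ Elsewhere-discard⇒canHelp (lab w) (parts≤ w)
    where open Sound sound

  canHelp-off-stack : ∀ {lab z} stk r → canHelp r (lab z) ≡ true → ∀ y → OnStack lab stk y → y ≢ z
  canHelp-off-stack stk r helps y (d , _ , inj₁ y-onPath) refl
    with () ← subst (λ L → canHelp r L ≡ true) y-onPath helps
  canHelp-off-stack stk r helps y (d , _ , inj₂ y-helper) refl
    with () ← subst (λ L → canHelp r L ≡ true) y-helper helps

  canHelp⇒Advance-helper : ∀ {r L d} → canHelp r L ≡ true → Advance r L (helper d)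
  canHelp⇒Advance-helper {L = free}   _     = free→helper
  canHelp⇒Advance-helper {r} {L = part c} helps = part→helper (canHelp-part⇒< {r} {c} helps)

  canHelp⇒not-current : ∀ {r L} → canHelp r L ≡ true → isPart r L ≡ false
  canHelp⇒not-current {L = free}   _     = refl
  canHelp⇒not-current {r} {L = part c} helps = isPart-other {r} {c} (>⇒≢ (canHelp-part⇒< {r} {c} helps))


  release : Labelling N → Maybe (Fin N) → Labelling N
  release lab nothing  = lab
  release lab (just h) = lab [ h ]≔ discarded

  module _ {lab : Labelling N} {d : ℕ} where

    release-Advance : ∀ {r} h → HelperAt lab h d → AdvanceStep r lab (release lab h)
    release-Advance nothing  _     v = stay
    release-Advance (just h) h-lab   =
      ≔-Advance lab h discarded _ (subst (λ L → Advance _ L discarded) (sym h-lab) helper→discarded)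

    count-release : (p : Status → Bool) → p (helper d) ≡ p discarded → ∀ h → HelperAt lab h d →
                    count (p ∘ release lab h) ≡ count (p ∘ lab)
    count-release p same nothing  _     = refl
    count-release p same (just h) h-lab = count-≔-same lab h discarded p (trans (cong p h-lab) same)

    release-WellLabelled : ∀ stk h → length stk ≡ d → HelperAt lab h d → WellLabelled lab stk →
                           WellLabelled (release lab h) stk
    release-WellLabelled stk nothing  _   _     wl = wl
    release-WellLabelled stk (just h) len h-lab wl = WellLabelled-≔ lab stk h discarded wl off
      where
      off : ∀ y → OnStack lab stk y → y ≢ h
      off y (d' , d'< , inj₁ y-onPath) refl with () ← trans (sym y-onPath) h-lab
      off y (d' , d'< , inj₂ y-helper) refl =
        <-irrefl (trans (helper-injective (trans (sym y-helper) h-lab)) (sym len)) d'<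

  module Round (n : ℕ) (no-path : ¬ Path23 F n) (r m W₀ : ℕ) (P₀ : ℕ → ℕ) (2m≤W₀ : m + m ≤ W₀) where

    record State : Set where
      constructor state
      field
        lab           : Labelling N
        stk           : List Entry
        used          : ℕ
        wellLabelled  : WellLabelled lab stk
        short         : length stk < n
        sound         : Sound r lab
        -- a vertex stops being free only when it is pushed (it is then on the stack or
        -- in part r) or when it becomes one of the used helpers
        free-budget   : W₀ ≤ #free lab + #part r lab + length stk + used
        used-budget   : used ≤ #part r lab + length stk
        earlier-parts : ∀ a → a < r → P₀ a ≤ #part a lab + used

    open State

    measure : State → ℕ
    measure s = 2 * #free (lab s) + length (stk s)

    Move : State → (ℕ → ℕ) → Set
    Move s grow = Σ State λ s' → measure s' < measure s × #part r (lab s') ≡ grow (#part r (lab s))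

    still-short : ∀ lab stk → WellLabelled lab stk → length stk ≤ n → length stk < n
    still-short lab stk wl ≤n with length stk ≟ n
    ... | yes ≡n = ⊥-elim (no-path (subst (Path23 F) ≡n (stack⇒path lab stk wl)))
    ... | no ≢n  = ≤∧≢⇒< ≤n ≢n

    push-via-2edge : (s : State) → ∀ t → lab s t ≡ free → StepsDown (t , nothing) (stk s) → Move s id
    push-via-2edge (state lab stk used wl short sound free-budget used-budget earlier) t t-free steps =
      state lab' ((t , nothing) ∷ stk) used wl' (still-short lab' _ wl' short) (Sound-Advance advance sound)
            free-budget' used-budget' earlier' ,
      measure-push (#free lab) (#free lab') L (≤-reflexive free-lost) ,
      same-part r
      where
      L : ℕ
      L = length stk
      lab' : Labelling N
      lab' = lab [ t ]≔ onPath L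
      advance : AdvanceStep r lab lab'
      advance = ≔-Advance lab t (onPath L) r (subst (λ S → Advance r S (onPath L)) (sym t-free) free→onPath)
      wl' : WellLabelled lab' ((t , nothing) ∷ stk)
      wl' = ≔-updates lab t (onPath L) , tt , steps ,
            WellLabelled-≔ lab stk t (onPath L) wl (canHelp-off-stack stk r (cong (canHelp r) t-free))
      free-lost : #free lab' + 1 ≡ #free lab
      free-lost = count-≔-lose lab t (onPath L) isFree (cong isFree t-free) refl
      same-part : ∀ a → #part a lab' ≡ #part a lab
      same-part a = count-≔-same lab t (onPath L) (isPart a) (cong (isPart a) t-free)
      free-budget' : W₀ ≤ #free lab' + #part r lab' + suc L + used
      free-budget' = begin
        W₀                                              ≤⟨ free-budget ⟩
        #free lab + #part r lab + L + used              ≡⟨ cong₂ (λ f p → f + p + L + used) free-lost (same-part r) ⟨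
        #free lab' + 1 + #part r lab' + L + used        ≡⟨ shift (#free lab') (#part r lab') L used ⟩
        #free lab' + #part r lab' + suc L + used        ∎
        where
        open ≤-Reasoning
        shift : ∀ f p l u → f + 1 + p + l + u ≡ f + p + suc l + u
        shift = solve-∀
      used-budget' : used ≤ #part r lab' + suc L
      used-budget' = subst (λ p → used ≤ p + suc L) (sym (same-part r))
                           (≤-trans used-budget (+-monoʳ-≤ (#part r lab) (n≤1+n L)))
      earlier' : ∀ a → a < r → P₀ a ≤ #part a lab' + used
      earlier' a a<r = subst (λ p → P₀ a ≤ p + used) (sym (same-part a)) (earlier a a<r)

    push-via-3edge : (s : State) → ∀ t w → lab s t ≡ free → canHelp r (lab s w) ≡ true → t ≢ w →
                       StepsDown (t , just w) (stk s) → Move s id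
    push-via-3edge (state lab stk used wl short sound free-budget used-budget earlier) t w t-free w-helps t≢w steps =
      state lab' ((t , just w) ∷ stk) (suc used) wl' (still-short lab' _ wl' short)
            (Sound-Advance advance (Sound-Advance recruit sound)) free-budget' used-budget' earlier' ,
      measure-push (#free lab) (#free lab') L
                   (≤-trans (≤-reflexive free-lost) (count-≔-≤ lab w (helper L) isFree refl)) ,
      same-current
      where
      L : ℕ
      L = length stk
      lab₁ lab' : Labelling N
      lab₁ = lab [ w ]≔ helper L
      lab' = lab₁ [ t ]≔ onPath L
      t-free₁ : lab₁ t ≡ free
      t-free₁ = trans (≔-minimal lab w (helper L) t t≢w) t-free
      recruit : AdvanceStep r lab lab₁
      recruit = ≔-Advance lab w (helper L) r (canHelp⇒Advance-helper w-helps)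
      advance : AdvanceStep r lab₁ lab'
      advance = ≔-Advance lab₁ t (onPath L) r (subst (λ S → Advance r S (onPath L)) (sym t-free₁) free→onPath)
      wl₁ : WellLabelled lab₁ stk
      wl₁ = WellLabelled-≔ lab stk w (helper L) wl (canHelp-off-stack stk r w-helps)
      wl' : WellLabelled lab' ((t , just w) ∷ stk)
      wl' = ≔-updates lab₁ t (onPath L) ,
            trans (≔-minimal lab₁ t (onPath L) w (t≢w ∘ sym)) (≔-updates lab w (helper L)) , steps ,
            WellLabelled-≔ lab₁ stk t (onPath L) wl₁ (canHelp-off-stack stk r (cong (canHelp r) t-free₁))
      free-lost : #free lab' + 1 ≡ #free lab₁
      free-lost = count-≔-lose lab₁ t (onPath L) isFree (cong isFree t-free₁) refl
      same-part : ∀ a → #part a lab' ≡ #part a lab₁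
      same-part a = count-≔-same lab₁ t (onPath L) (isPart a) (cong (isPart a) t-free₁)
      same-current : #part r lab' ≡ #part r lab
      same-current = trans (same-part r)
        (count-≔-same lab w (helper L) (isPart r) (canHelp⇒not-current {r} {lab w} w-helps))
      free-budget' : W₀ ≤ #free lab' + #part r lab' + suc L + suc used
      free-budget' = begin
        W₀                                        ≤⟨ free-budget ⟩
        #free lab + #part r lab + L + used        ≤⟨ +-monoˡ-≤ used (+-monoˡ-≤ L (+-monoˡ-≤ (#part r lab) free-lost₂)) ⟩
        #free lab' + 2 + #part r lab + L + used   ≡⟨ cong (λ p → #free lab' + 2 + p + L + used) same-current ⟨
        #free lab' + 2 + #part r lab' + L + used  ≡⟨ shift (#free lab') (#part r lab') L used ⟩
        #free lab' + #part r lab' + suc L + suc used ∎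
        where
        open ≤-Reasoning
        free-lost₂ : #free lab ≤ #free lab' + 2
        free-lost₂ = ≤-trans (count-≔-≥ lab w (helper L) isFree)
                             (≤-reflexive (trans (cong (_+ 1) (sym free-lost)) (+-assoc (#free lab') 1 1)))
        shift : ∀ f p l u → f + 2 + p + l + u ≡ f + p + suc l + suc u
        shift = solve-∀
      used-budget' : suc used ≤ #part r lab' + suc L
      used-budget' = subst (λ p → suc used ≤ p + suc L) (sym same-current)
                           (≤-trans (s≤s used-budget) (≤-reflexive (sym (+-suc (#part r lab) L))))
      earlier' : ∀ a → a < r → P₀ a ≤ #part a lab' + suc used
      earlier' a a<r = begin
        P₀ a                           ≤⟨ earlier a a<r ⟩
        #part a lab + used             ≤⟨ +-monoˡ-≤ used (count-≔-≥ lab w (helper L) (isPart a)) ⟩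
        #part a lab₁ + 1 + used        ≡⟨ cong (λ p → p + 1 + used) (same-part a) ⟨
        #part a lab' + 1 + used        ≡⟨ +-assoc (#part a lab') 1 used ⟩
        #part a lab' + suc used        ∎
        where open ≤-Reasoning

    pop : (s : State) → ∀ x h rest → stk s ≡ (x , h) ∷ rest → Blocked r (lab s) x → Move s suc
    pop (state lab _ used (x-onPath , h-lab , _ , wl) short sound free-budget used-budget earlier) x h rest refl x-blocked =
      state lab' rest used wl' (≤-trans (n≤1+n _) short)
            (Sound-Advance (release-Advance h h-lab₁) (Sound-pop x-onPath x-blocked sound))
            free-budget' used-budget' earlier' ,
      subst (λ f → 2 * f + L < 2 * #free lab + suc L) (sym same-free) (+-monoʳ-< (2 * #free lab) (n<1+n L)) ,
      current-grows
      where
      L : ℕ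
      L = length rest
      lab₁ lab' : Labelling N
      lab₁ = lab [ x ]≔ part r
      lab' = release lab₁ h
      h-lab₁ : HelperAt lab₁ h L
      h-lab₁ = kept h h-lab
        where
        kept : ∀ h → HelperAt lab h L → HelperAt lab₁ h L
        kept nothing  _     = tt
        kept (just v) v-lab = trans (≔-minimal lab x (part r) v v≢x) v-lab
          where
          v≢x : v ≢ x
          v≢x refl with () ← trans (sym v-lab) x-onPath
      wl' : WellLabelled lab' rest
      wl' = release-WellLabelled rest h refl h-lab₁ (WellLabelled-≔ lab rest x (part r) wl off)
        where
        off : ∀ y → OnStack lab rest y → y ≢ x
        off y (d , d< , inj₁ y-onPath) refl = <-irrefl (onPath-injective (trans (sym y-onPath) x-onPath)) d<
        off y (d , d< , inj₂ y-helper) refl with () ← trans (sym y-helper) x-onPath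
      same-free : #free lab' ≡ #free lab
      same-free = trans (count-release isFree refl h h-lab₁)
                        (count-≔-same lab x (part r) isFree (cong isFree x-onPath))
      current-grows : #part r lab' ≡ suc (#part r lab)
      current-grows = trans (count-release (isPart r) refl h h-lab₁)
                            (count-≔-gain lab x (part r) (isPart r) (cong (isPart r) x-onPath) (isPart-self r))
      same-earlier : ∀ a → a < r → #part a lab' ≡ #part a lab
      same-earlier a a<r = trans (count-release (isPart a) refl h h-lab₁)
        (count-≔-same lab x (part r) (isPart a) (trans (cong (isPart a) x-onPath) (sym (isPart-other (<⇒≢ a<r)))))
      free-budget' : W₀ ≤ #free lab' + #part r lab' + L + used
      free-budget' = begin
        W₀                                       ≤⟨ free-budget ⟩
        #free lab + #part r lab + suc L + used   ≡⟨ shift (#free lab) (#part r lab) L used ⟩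
        #free lab + suc (#part r lab) + L + used ≡⟨ cong₂ (λ f p → f + p + L + used) same-free current-grows ⟨
        #free lab' + #part r lab' + L + used     ∎
        where
        open ≤-Reasoning
        shift : ∀ f p l u → f + p + suc l + u ≡ f + suc p + l + u
        shift = solve-∀
      used-budget' : used ≤ #part r lab' + L
      used-budget' = subst (λ p → used ≤ p + L) (sym current-grows)
                           (≤-trans used-budget (≤-reflexive (+-suc (#part r lab) L)))
      earlier' : ∀ a → a < r → P₀ a ≤ #part a lab' + used
      earlier' a a<r = subst (λ p → P₀ a ≤ p + used) (sym (same-earlier a a<r)) (earlier a a<r)

    some-free : (s : State) → stk s ≡ [] → #part r (lab s) < m → ∃[ v ] lab s v ≡ free
    some-free s empty current<m with #free (lab s) ≟ 0
    ... | no  free≢0 = let v , v-free = count-witness (isFree ∘ lab s) (n≢0⇒n>0 free≢0)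
                       in v , isFree⇒≡free v-free
    ... | yes free≡0 = ⊥-elim (<-irrefl refl (begin-strict
      W₀                      ≤⟨ free-budget s ⟩
      #free (lab s) + P + length (stk s) + used s
        ≡⟨ cong₂ (λ f l → f + P + l + used s) free≡0 (cong length empty) ⟩
      P + 0 + used s
        ≤⟨ +-monoʳ-≤ (P + 0) (subst (λ l → used s ≤ P + l) (cong length empty) (used-budget s)) ⟩
      P + 0 + (P + 0)         <⟨ +-mono-< (+-monoˡ-< 0 current<m) (+-monoˡ-< 0 current<m) ⟩
      m + 0 + (m + 0)         ≡⟨ cong₂ _+_ (+-identityʳ m) (+-identityʳ m) ⟩
      m + m                   ≤⟨ 2m≤W₀ ⟩
      W₀                      ∎))
      where
      open ≤-Reasoning
      P : ℕ
      P = #part r (lab s)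

    Progress : State → Set
    Progress s = Σ State λ s' → measure s' < measure s × #part r (lab s') ≤ m

    step-on : (s : State) → #part r (lab s) < m → ∀ top → stk s ≡ top → Progress s
    step-on s current<m [] stack =
      let v , v-free = some-free s stack current<m
          s' , smaller , same = push-via-2edge s v v-free (subst (StepsDown (v , nothing)) (sym stack) tt)
      in s' , smaller , ≤-trans (≤-reflexive same) (<⇒≤ current<m)
    step-on s current<m ((x , h) ∷ rest) stack
      with any? (λ t → (isFree (lab s t) ≟ᵇ true) ×-dec (adj2 F x t ≟ᵇ true))
    ... | yes (t , t-free , x~t) =
      let s' , smaller , same = push-via-2edge s t (isFree⇒≡free t-free)
                                  (subst (StepsDown (t , nothing)) (sym stack) (trans (adj2-sym t x) x~t))
      in s' , smaller , ≤-trans (≤-reflexive same) (<⇒≤ current<m)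
    ... | no no-edge
      with any? (λ t → any? (λ w → (isFree (lab s t) ≟ᵇ true) ×-dec
                                   ((canHelp r (lab s w) ≟ᵇ true) ×-dec
                                    (adj3 F x t w ≟ᵇ true))))
    ...   | yes (t , w , t-free , w-helps , x~t[w]) =
      let s' , smaller , same = push-via-3edge s t w (isFree⇒≡free t-free) w-helps (adj3-distinct x t w x~t[w])
                                  (subst (StepsDown (t , just w)) (sym stack) (trans (adj3-sym t x w) x~t[w]))
      in s' , smaller , ≤-trans (≤-reflexive same) (<⇒≤ current<m)
    ...   | no no-3edge =
      let s' , smaller , grows = pop s x h rest stack blocked
      in s' , smaller , ≤-trans (≤-reflexive grows) current<m
      where
      blocked : Blocked r (lab s) x
      blocked t w t-free = (λ x~t → no-edge (t , cong isFree t-free , x~t)) ,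
                           (λ w-helps x~t[w] → no-3edge (t , w , cong isFree t-free , w-helps , x~t[w]))

    step : (s : State) → #part r (lab s) < m → Progress s
    step s current<m = step-on s current<m (stk s) refl

    run : (fuel : ℕ) (s : State) → measure s < fuel → #part r (lab s) ≤ m →
          Σ State λ s' → #part r (lab s') ≡ m
    run (suc fuel) s bound current≤m with m ≤? #part r (lab s)
    ... | yes m≤current = s , ≤-antisym current≤m m≤current
    ... | no  m≰current =
      let s' , smaller , current'≤m = step s (≰⇒> m≰current)
      in run fuel s' (<-≤-trans smaller (s≤s⁻¹ bound)) current'≤m

  PartsBelow : ℕ → Labelling N → Set
  PartsBelow r lab = ∀ v b → lab v ≡ part b → b < r

  module _ (n : ℕ) (0<n : 0 < n) (no-path : ¬ Path23 F n) where

    record RoundOutcome (r m : ℕ) (lab : Labelling N) : Set where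
      field
        next         : Labelling N
        below        : PartsBelow (suc r) next
        separated    : Separated (suc r) next
        size         : #part r next ≡ m
        free-cost    : #free lab ≤ #free next + ((m + n) + (m + n))
        earlier-cost : ∀ a → a < r → #part a lab ≤ #part a next + (m + n)

    round : ∀ r m lab → PartsBelow r lab → Separated r lab → m + m ≤ #free lab → RoundOutcome r m lab
    round r m lab below separated 2m≤free = record
      { next         = next
      ; below        = λ v b v-in → s≤s (Sound.parts≤ Final.sound v b (discard-part v-in))
      ; separated    = close-round Final.sound
      ; size         = trans (same-part r) reached
      ; free-cost    = free-cost
      ; earlier-cost = λ a a<r → ≤-trans (Final.earlier-parts a a<r)
                                         (+-mono-≤ (≤-reflexive (sym (same-part a))) used≤)
      }
      where
      open Round n no-path r m (#free lab) (λ a → #part a lab) 2m≤free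
      no-current : #part r lab ≡ 0
      no-current = count-false (isPart r ∘ lab) λ v → not-current (lab v) (below v)
        where
        not-current : ∀ L → (∀ b → L ≡ part b → b < r) → isPart r L ≡ false
        not-current free       _     = refl
        not-current (part b)   b<r   = isPart-other (>⇒≢ (b<r b refl))
        not-current (onPath _) _     = refl
        not-current (helper _) _     = refl
        not-current discarded  _     = refl
      start : State
      start = state lab [] 0 tt 0<n
        (record { separated   = separated
                ; partBlocked = λ s s-in → ⊥-elim (<-irrefl refl (below s r s-in))
                ; parts≤      = λ v b v-in → <⇒≤ (below v b v-in) })
        (≤-trans (m≤m+n _ (#part r lab)) (≤-reflexive (sym (trans (+-identityʳ _) (+-identityʳ _)))))
        z≤n (λ a _ → m≤m+n _ 0)
      result : Σ State λ s → #part r (State.lab s) ≡ m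
      result = run (suc (measure start)) start ≤-refl (≤-trans (≤-reflexive no-current) z≤n)
      module Final = State (proj₁ result)
      reached : #part r Final.lab ≡ m
      reached = proj₂ result
      next : Labelling N
      next = discard ∘ Final.lab
      same-free : #free next ≡ #free Final.lab
      same-free = count-cong (isFree-discard ∘ Final.lab)
      same-part : ∀ a → #part a next ≡ #part a Final.lab
      same-part a = count-cong (isPart-discard a ∘ Final.lab)
      used≤ : Final.used ≤ m + n
      used≤ = ≤-trans Final.used-budget (+-mono-≤ (≤-reflexive reached) (<⇒≤ Final.short))
      free-cost : #free lab ≤ #free next + ((m + n) + (m + n))
      free-cost = begin
        #free lab                                                ≤⟨ Final.free-budget ⟩
        #free Final.lab + #part r Final.lab + length Final.stk + Final.used
          ≤⟨ +-mono-≤ (+-mono-≤ (+-monoʳ-≤ (#free Final.lab) (≤-reflexive reached)) (<⇒≤ Final.short))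
                      used≤ ⟩
        #free Final.lab + m + n + (m + n)                        ≡⟨ regroup (#free Final.lab) m n ⟩
        #free Final.lab + ((m + n) + (m + n))                    ≡⟨ cong (_+ ((m + n) + (m + n))) same-free ⟨
        #free next + ((m + n) + (m + n))                         ∎
        where
        open ≤-Reasoning
        regroup : ∀ f a b → f + a + b + (a + b) ≡ f + ((a + b) + (a + b))
        regroup = solve-∀

    module _ (X : ℕ) (n≤X : n ≤ X) (K : ℕ) where

      record Outcome (r j : ℕ) (lab : Labelling N) : Set where
        field
          final        : Labelling N
          separated    : Separated K final
          free-left    : X ≤ #free final
          parts-large  : ∀ a → r ≤ a → a < K → X ≤ #part a final
          earlier-cost : ∀ a → a < r → #part a lab ≤ #part a final + loss X j

      rounds : ∀ j r → r + j ≡ K → ∀ lab → PartsBelow r lab → Separated r lab → demand X j ≤ #free lab →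
               Outcome r j lab
      rounds zero r r+0≡K lab below separated enough = record
        { final        = lab
        ; separated    = subst (λ k → Separated k lab) r≡K separated
        ; free-left    = enough
        ; parts-large  = λ a r≤a a<K → ⊥-elim (<-irrefl refl (<-≤-trans a<K (subst (_≤ a) r≡K r≤a)))
        ; earlier-cost = λ a _ → m≤m+n _ 0
        }
        where
        r≡K : r ≡ K
        r≡K = trans (sym (+-identityʳ r)) r+0≡K
      rounds (suc j) r r+1+j≡K lab below separated enough = record
        { final        = Rest.final
        ; separated    = Rest.separated
        ; free-left    = Rest.free-left
        ; parts-large  = parts-large
        ; earlier-cost = earlier-cost
        }
        where
        m cost : ℕ
        m = target X j
        cost = (m + X) + (m + X)
        round-cost≤ : (m + n) + (m + n) ≤ cost
        round-cost≤ = +-mono-≤ (+-monoʳ-≤ m n≤X) (+-monoʳ-≤ m n≤X)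
        2m≤free : m + m ≤ #free lab
        2m≤free = ≤-trans (+-mono-≤ (m≤m+n m X) (m≤m+n m X)) (≤-trans (m≤n+m cost (demand X j)) enough)
        module This = RoundOutcome (round r m lab below separated 2m≤free)
        enough′ : demand X j ≤ #free This.next
        enough′ = +-cancelʳ-≤ cost (demand X j) (#free This.next)
          (≤-trans enough (≤-trans This.free-cost (+-monoʳ-≤ (#free This.next) round-cost≤)))
        module Rest = Outcome (rounds j (suc r) (trans (sym (+-suc r j)) r+1+j≡K)
                                      This.next This.below This.separated enough′)
        parts-large : ∀ a → r ≤ a → a < K → X ≤ #part a Rest.final
        parts-large a r≤a a<K with r ≟ a
        ... | yes refl = +-cancelʳ-≤ (loss X j) X (#part r Rest.final)
                           (≤-trans (≤-reflexive (sym This.size)) (Rest.earlier-cost r ≤-refl))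
        ... | no r≢a   = Rest.parts-large a (≤∧≢⇒< r≤a r≢a) a<K
        earlier-cost : ∀ a → a < r → #part a lab ≤ #part a Rest.final + loss X (suc j)
        earlier-cost a a<r = begin
          #part a lab                            ≤⟨ This.earlier-cost a a<r ⟩
          #part a This.next + (m + n)
            ≤⟨ +-mono-≤ (Rest.earlier-cost a (m<n⇒m<1+n a<r)) (+-monoʳ-≤ m n≤X) ⟩
          #part a Rest.final + loss X j + (m + X) ≡⟨ +-assoc (#part a Rest.final) (loss X j) (m + X) ⟩
          #part a Rest.final + loss X (suc j)    ∎
          where open ≤-Reasoning

inClass : ℕ → ℕ → Status → Bool
inClass K i L = if i <ᵇ K then isPart i L else isFree L

inClass-part : ∀ {K i} L → i < K → inClass K i L ≡ isPart i L
inClass-part {K} {i} L i<K rewrite Equivalence.to T-≡ (<⇒<ᵇ i<K) = refl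

inClass-free : ∀ {K i} L → ¬ i < K → inClass K i L ≡ isFree L
inClass-free {K} {i} L i≮K with i <ᵇ K in eq
... | true  = ⊥-elim (i≮K (<ᵇ⇒< i K (Equivalence.from T-≡ eq)))
... | false = refl

module Extraction {N : ℕ} (F : Graph23 N) (K X : ℕ) (lab : Labelling N)
                  (separated : Graph.Separated F K lab)
                  (free-left : X ≤ Graph.#free F lab)
                  (parts-large : ∀ a → a < K → X ≤ Graph.#part F a lab) where

  open Graph F

  V : Fin (suc K) → Subset N
  V i = tabulate (inClass K (toℕ i) ∘ lab)

  ClassOf : Fin N → ℕ → Set
  ClassOf u i = (i < K × lab u ≡ part i) ⊎ (i ≡ K × lab u ≡ free)

  ∈V⇒ClassOf : ∀ i u → u ∈ V i → ClassOf u (toℕ i)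
  ∈V⇒ClassOf i u u∈V with toℕ i <? K | ∈-tabulate (inClass K (toℕ i) ∘ lab) u u∈V
  ... | yes i<K | in-class =
    inj₁ (i<K , isPart⇒≡part (toℕ i) (lab u) (trans (sym (inClass-part (lab u) i<K)) in-class))
  ... | no  i≮K | in-class = inj₂ (≤-antisym (s≤s⁻¹ (toℕ<n i)) (≮⇒≥ i≮K) ,
                                   isFree⇒≡free (trans (sym (inClass-free (lab u) i≮K)) in-class))

  ∣V∣ : ∀ i → ∣ V i ∣ ≡ count (inClass K (toℕ i) ∘ lab)
  ∣V∣ i = ∣tabulate∣≡count (inClass K (toℕ i) ∘ lab)

  V-large : ∀ i → X ≤ ∣ V i ∣
  V-large i with toℕ i <? K
  ... | yes i<K = subst (X ≤_) (sym (trans (∣V∣ i) (count-cong (λ v → inClass-part (lab v) i<K))))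
                        (parts-large (toℕ i) i<K)
  ... | no  i≮K = subst (X ≤_) (sym (trans (∣V∣ i) (count-cong (λ v → inClass-free (lab v) i≮K))))
                        free-left

  V-disjoint : ∀ i j u → u ∈ V i → u ∈ V j → i ≡ j
  V-disjoint i j u u∈i u∈j with ∈V⇒ClassOf i u u∈i | ∈V⇒ClassOf j u u∈j
  ... | inj₁ (_ , u-i) | inj₁ (_ , u-j) = toℕ-injective (part-injective (trans (sym u-i) u-j))
  ... | inj₂ (i≡K , _) | inj₂ (j≡K , _) = toℕ-injective (trans i≡K (sym j≡K))
  ... | inj₁ (_ , u-i) | inj₂ (_ , u-free) with () ← trans (sym u-i) u-free
  ... | inj₂ (_ , u-free) | inj₁ (_ , u-j) with () ← trans (sym u-j) u-free

  ClassOf-≤ : ∀ {v b} → ClassOf v b → b ≤ K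
  ClassOf-≤ (inj₁ (b<K , _)) = <⇒≤ b<K
  ClassOf-≤ (inj₂ (b≡K , _)) = ≤-reflexive b≡K

  ClassOf-After : ∀ {v a b} → ClassOf v b → a < b → After a (lab v)
  ClassOf-After (inj₁ (_ , v-b))    a<b = subst (After _) (sym v-b) a<b
  ClassOf-After (inj₂ (_ , v-free)) a<b = subst (After _) (sym v-free) tt

  ClassOf-Elsewhere : ∀ {w a c} → ClassOf w c → a ≢ c → Elsewhere a (lab w)
  ClassOf-Elsewhere {a = a} {c} (inj₁ (_ , w-c)) a≢c with <-cmp a c
  ... | tri< a<c _ _ = inj₁ (subst (After a) (sym w-c) a<c)
  ... | tri≈ _ a≡c _ = ⊥-elim (a≢c a≡c)
  ... | tri> _ _ c<a = inj₂ (subst (Before a) (sym w-c) c<a)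
  ClassOf-Elsewhere (inj₂ (_ , w-free)) _ = inj₁ (subst (After _) (sym w-free) tt)

  classes-separated : ∀ {u v a b} → ClassOf u a → ClassOf v b → a < b →
                      ¬ adj2 F u v ≡ true × (∀ {w c} → ClassOf w c → a ≢ c → ¬ adj3 F u v w ≡ true)
  classes-separated (inj₂ (refl , _)) v-class a<b = ⊥-elim (<⇒≱ a<b (ClassOf-≤ v-class))
  classes-separated {u} {v} {a} (inj₁ (a<K , u-a)) v-class a<b =
    proj₁ (separated u v u a u-a a<K (ClassOf-After v-class a<b)) ,
    λ {w} w-class a≢c →
      proj₂ (separated u v w a u-a a<K (ClassOf-After v-class a<b)) (ClassOf-Elsewhere w-class a≢c)

  no-transversal2 : ∀ u v → adj2 F u v ≡ true → ¬ Transversal2 V u v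
  no-transversal2 u v u~v (i , j , i≢j , u∈i , v∈j)
    with ∈V⇒ClassOf i u u∈i | ∈V⇒ClassOf j v v∈j | <-cmp (toℕ i) (toℕ j)
  ... | u-class | v-class | tri< i<j _ _ = proj₁ (classes-separated u-class v-class i<j) u~v
  ... | _       | _       | tri≈ _ i≡j _ = i≢j (toℕ-injective i≡j)
  ... | u-class | v-class | tri> _ _ j<i =
    proj₁ (classes-separated v-class u-class j<i) (trans (adj2-sym v u) u~v)

  no-transversal3 : ∀ u v w → adj3 F u v w ≡ true → ¬ Transversal3 V u v w
  no-transversal3 u v w uv[w] (i , j , l , i≢j , i≢l , j≢l , u∈i , v∈j , w∈l)
    with ∈V⇒ClassOf i u u∈i | ∈V⇒ClassOf j v v∈j | ∈V⇒ClassOf l w w∈l | <-cmp (toℕ i) (toℕ j)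
  ... | u-class | v-class | w-class | tri< i<j _ _ =
    proj₂ (classes-separated u-class v-class i<j) w-class (i≢l ∘ toℕ-injective) uv[w]
  ... | _       | _       | _       | tri≈ _ i≡j _ = i≢j (toℕ-injective i≡j)
  ... | u-class | v-class | w-class | tri> _ _ j<i =
    proj₂ (classes-separated v-class u-class j<i) w-class (j≢l ∘ toℕ-injective) (trans (adj3-sym v u w) uv[w])

  no-edge-into-last : ∀ u v w → adj3 F u v w ≡ true →
                      ¬ ((∃[ i ] (suc (toℕ i) < suc K × u ∈ V i)) ×
                         (∃[ l ] (suc (toℕ l) ≡ suc K × v ∈ V l × w ∈ V l)))
  no-edge-into-last u v w uv[w] ((i , i<K , u∈i) , (l , l≡K , v∈l , w∈l)) =
    proj₂ (classes-separated (∈V⇒ClassOf i u u∈i) (∈V⇒ClassOf l v v∈l) i<l)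
          (∈V⇒ClassOf l w w∈l) (<⇒≢ i<l) uv[w]
    where
    i<l : toℕ i < toℕ l
    i<l = subst (toℕ i <_) (sym (suc-injective l≡K)) (s≤s⁻¹ i<K)

lemma3p2 : (k c n N : ℕ) → 1 ≤ k → 1 ≤ c → 1 ≤ n → (F : Graph23 N) →
           5 ^ (k ∸ 1) * c * n ≤ N →
           ¬ Path23 F n →
           Σ (Fin k → Subset N) λ V →
             (∀ i j (u : Fin N) → u ∈ V i → u ∈ V j → i ≡ j) ×
             (∀ i → c * n ≤ ∣ V i ∣) ×
             (∀ u v → adj2 F u v ≡ true → ¬ Transversal2 V u v) ×
             (∀ u v w → adj3 F u v w ≡ true → ¬ Transversal3 V u v w) ×
             (∀ u v w → adj3 F u v w ≡ true →
                ¬ ((∃[ i ] (suc (toℕ i) < k × u ∈ V i)) ×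
                   (∃[ l ] (suc (toℕ l) ≡ k × v ∈ V l × w ∈ V l))))
lemma3p2 (suc K) c n N _ 1≤c 1≤n F large no-path =
  V , V-disjoint , V-large , no-transversal2 , no-transversal3 , no-edge-into-last
  where
  open Graph F
  X : ℕ
  X = c * n
  n≤X : n ≤ X
  n≤X = m≤n*m n c {{>-nonZero 1≤c}}
  enough : demand X K ≤ #free (const free)
  enough = begin
    demand X K     ≤⟨ proj₂ (loss-demand-bound X K) ⟩
    5 ^ K * X      ≡⟨ *-assoc (5 ^ K) c n ⟨
    5 ^ K * c * n  ≤⟨ large ⟩
    N              ≡⟨ count-true (isFree ∘ const free) (λ _ → refl) ⟨
    #free (const free) ∎
    where open ≤-Reasoning
  module Result = Outcome
    (rounds n 1≤n no-path X n≤X K K 0 refl (const free) (λ _ _ ()) (λ _ _ _ _ _ ()) enough)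
  open Extraction F K X Result.final Result.separated Result.free-left (λ a → Result.parts-large a z≤n)
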